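{- Let $k\ge1$, $n\ge1$. A tableau $T\in\mathcal T^k_n$ is uniquely determined by its first row entries, and also uniquely determined by its bottom row entries. Moreover: (i) an increasing sequence $(t_1,\dots,t_n)$ with $t_1=1$ is the first row of some $T\in\mathcal T^k_n$ if and only if $t_j\le 1+(j-1)(k+1)$ for all $j$; (ii) an increasing sequence $(b_1,\dots,b_n)$ with $b_n=(k+1)n$ is the bottom row of some $T\in\mathcal T^k_n$ if and only if $b_j\ge j(k+1)$ for all $j$.
   Context: $\mathcal T^k_n$ is the set of arrays with $k+1$ rows and $n$ columns containing each of $1,\dots,(k+1)n$ once, increasing along rows (left to right) and down columns (top to bottom), such that whenever $a<b<c<d$ with $d$ immediately below $a$, the entries $b$ and $c$ are not in the same column. The first row is the top row; the bottom row is row $k+1$. -}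

module Defs where

open import Data.Nat using (ℕ; zero; suc; _+_; _*_; _∸_; _≤_; _<_)
open import Data.Fin as Fin using (Fin; toℕ; inject₁; fromℕ)
open import Data.Product using (_×_; ∃; ∃-syntax; Σ-syntax)
open import Data.Empty using (⊥)
open import Relation.Binary.PropositionalEquality using (_≡_)

-- An array with (k+1) rows and n columns; T i j is the entry in row i
-- (row 0 = top row, row fromℕ k = bottom row) and column j (column 0 = leftmost).
Array : ℕ → ℕ → Set
Array k n = Fin (suc k) → Fin n → ℕ

ContainsEachOnce : (k n : ℕ) → Array k n → Set
ContainsEachOnce k n T =
  (∀ i j → 1 ≤ T i j × T i j ≤ suc k * n)
  × (∀ m → 1 ≤ m → m ≤ suc k * n → ∃[ i ] ∃[ j ] (T i j ≡ m))
  × (∀ i j i′ j′ → T i j ≡ T i′ j′ → i ≡ i′ × j ≡ j′)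

RowsIncreasing : (k n : ℕ) → Array k n → Set
RowsIncreasing k n T = ∀ i (j j′ : Fin n) → j Fin.< j′ → T i j < T i j′

ColumnsIncreasing : (k n : ℕ) → Array k n → Set
ColumnsIncreasing k n T = ∀ (i i′ : Fin (suc k)) j → i Fin.< i′ → T i j < T i′ j

-- whenever a < b < c < d with d immediately below a, b and c are not in the
-- same column.  Here a = T (inject₁ r) j, d = T (suc r) j, and b = T s c,
-- c = T s′ c for positions in a common column c.
Avoiding : (k n : ℕ) → Array k n → Set
Avoiding k n T =
  ∀ (r : Fin k) (j : Fin n) (s s′ : Fin (suc k)) (c : Fin n) →
    T (inject₁ r) j < T s c → T s c < T s′ c → T s′ c < T (Fin.suc r) j → ⊥

InT : (k n : ℕ) → Array k n → Set
InT k n T = ContainsEachOnce k n T × RowsIncreasing k n T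
          × ColumnsIncreasing k n T × Avoiding k n T

topRow : ∀ {k n} → Array k n → Fin n → ℕ
topRow T = T Fin.zero

bottomRow : ∀ {k n} → Array k n → Fin n → ℕ
bottomRow {k} T = T (fromℕ k)

StrictlyIncreasing : ∀ {n} → (Fin n → ℕ) → Set
StrictlyIncreasing {n} t = ∀ (j j′ : Fin n) → j Fin.< j′ → t j < t j′

-- Two arrays of 𝒯 with the same top row put every value m into the same cell, by induction on m:
-- were the two cells of m in different columns, the entries above them would produce the
-- forbidden pattern.  The values below the top entry of column j all lie in the j columns to its
-- left, which bounds that entry by 1 + j (k + 1).  Conversely, if the keys i U + x j of the cells
-- (i, j) are distinct, their ranks form an array of 𝒯, since the keys strictly between a key and
-- the one below it meet each column at most once; every admissible top row is realised this way,
-- adding one column at a time.  A half turn that also replaces each entry v by (k + 1) n + 1 − v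
-- preserves 𝒯 and exchanges the top and bottom rows.
module Submission where

open import Defs
open import Data.Nat using (ℕ; suc; _+_; _*_; _∸_; _≤_)
open import Data.Fin using (Fin; toℕ)
open import Data.Product using (_×_; ∃-syntax)
open import Relation.Binary.PropositionalEquality using (_≡_)
open import Function.Bundles using (_⇔_)

open import Level using (Level)
open import Data.Nat using (zero; pred; _<_; _≤?_; z≤n; s≤s; s≤s⁻¹; NonZero; >-nonZero)
open import Data.Nat.Properties
open import Data.Nat.Tactic.RingSolver using (solve-∀)
open import Data.Fin as Fin using (zero; suc; inject₁; fromℕ; fromℕ<; opposite; combine; remQuot)
import Data.Fin.Properties as Finₚ
open import Data.Fin.Properties using (toℕ-injective; toℕ-inject₁; toℕ-fromℕ; toℕ-fromℕ<; toℕ<n)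
import Data.Fin.Relation.Unary.Top as Top
open Top using (‵fromℕ; ‵inject₁)
open import Data.Product using (_,_; proj₁; proj₂; ∃; uncurry; swap; map₂)
open import Data.Product.Properties using (×-≡,≡→≡)
open import Data.Sum using (inj₁; inj₂)
open import Data.Empty using (⊥-elim)
open import Function using (_∘_)
open import Function.Bundles using (mk⇔; Equivalence)
open import Function.Definitions using (Injective)
open import Relation.Nullary using (¬_; Dec; yes; no; contradiction)
open import Relation.Binary using (tri<; tri≈; tri>)
open import Relation.Binary.PropositionalEquality
  using (_≢_; refl; sym; trans; cong; cong₂; subst; subst₂; module ≡-Reasoning)
open import Algebra.Properties.Monoid.Sum +-0-monoid
  using (sum; sum-cong-≗; sum-init-last; sum-replicate-zero)

open Equivalence using (to; from)

private
  variable
    ℓ ℓ′ : Level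
    P : Set ℓ
    k n m : ℕ
    S T T′ : Array k n

-- Counting

𝟙 : Dec P → ℕ
𝟙 (yes _) = 1
𝟙 (no _)  = 0

𝟙-yes : (P? : Dec P) → P → 𝟙 P? ≡ 1
𝟙-yes (yes _) _ = refl
𝟙-yes (no ¬p) p = contradiction p ¬p

𝟙-no : (P? : Dec P) → ¬ P → 𝟙 P? ≡ 0
𝟙-no (yes p) ¬p = contradiction p ¬p
𝟙-no (no _)  _  = refl

𝟙≤1 : (P? : Dec P) → 𝟙 P? ≤ 1
𝟙≤1 (yes _) = ≤-refl
𝟙≤1 (no _)  = z≤n

𝟙-mono : {Q : Set ℓ′} (P? : Dec P) (Q? : Dec Q) → (P → Q) → 𝟙 P? ≤ 𝟙 Q?
𝟙-mono (yes p) (yes _) _   = ≤-refl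
𝟙-mono (yes p) (no ¬q) P→Q = contradiction (P→Q p) ¬q
𝟙-mono (no _)  _       _   = z≤n

𝟙-< : {Q : Set ℓ′} (P? : Dec P) (Q? : Dec Q) → ¬ P → Q → 𝟙 P? < 𝟙 Q?
𝟙-< P? Q? ¬p q rewrite 𝟙-no P? ¬p | 𝟙-yes Q? q = ≤-refl

𝟙-cong : {Q : Set ℓ′} (P? : Dec P) (Q? : Dec Q) → P ⇔ Q → 𝟙 P? ≡ 𝟙 Q?
𝟙-cong P? Q? P⇔Q = ≤-antisym (𝟙-mono P? Q? (to P⇔Q)) (𝟙-mono Q? P? (from P⇔Q))

sum-const : ∀ n c → sum {n} (λ _ → c) ≡ n * c
sum-const zero    c = refl
sum-const (suc n) c = cong (c +_) (sum-const n c)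

sum-mono-≤ : {f g : Fin n → ℕ} → (∀ i → f i ≤ g i) → sum f ≤ sum g
sum-mono-≤ {zero}  _   = z≤n
sum-mono-≤ {suc n} f≤g = +-mono-≤ (f≤g zero) (sum-mono-≤ (f≤g ∘ suc))

sum-mono-< : {f g : Fin n → ℕ} → (∀ i → f i ≤ g i) → ∀ a → f a < g a → sum f < sum g
sum-mono-< f≤g zero    fa<ga = +-mono-<-≤ fa<ga (sum-mono-≤ (f≤g ∘ suc))
sum-mono-< f≤g (suc a) fa<ga = +-mono-≤-< (f≤g zero) (sum-mono-< (f≤g ∘ suc) a fa<ga)

sum-𝟙-none : {P : Fin n → Set ℓ} (P? : ∀ i → Dec (P i)) → (∀ i → ¬ P i) → sum (𝟙 ∘ P?) ≡ 0
sum-𝟙-none {n} P? none = trans (sum-cong-≗ (λ i → 𝟙-no (P? i) (none i))) (sum-replicate-zero n)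

sum-𝟙-first : {P : Fin (suc n) → Set ℓ} (P? : ∀ i → Dec (P i)) →
  P zero → (∀ i → ¬ P (suc i)) → sum (𝟙 ∘ P?) ≡ 1
sum-𝟙-first P? first rest = cong₂ _+_ (𝟙-yes (P? zero) first) (sum-𝟙-none (P? ∘ suc) rest)

∑cells : Array k n → ℕ
∑cells f = sum λ j → sum λ i → f i j

∑cells-mono-≤ : {f g : Array k n} → (∀ i j → f i j ≤ g i j) → ∑cells f ≤ ∑cells g
∑cells-mono-≤ f≤g = sum-mono-≤ λ j → sum-mono-≤ λ i → f≤g i j

∑cells-mono-< : {f g : Array k n} → (∀ i j → f i j ≤ g i j) →
  ∀ i j → f i j < g i j → ∑cells f < ∑cells g
∑cells-mono-< f≤g i j lt =
  sum-mono-< (λ j → sum-mono-≤ λ i → f≤g i j) j (sum-mono-< (λ i → f≤g i j) i lt)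

∑cells-const : ∀ c → ∑cells {k} {n} (λ _ _ → c) ≡ suc k * n * c
∑cells-const {k} {n} c = begin
  sum {n} (λ _ → sum {suc k} λ _ → c) ≡⟨ sum-cong-≗ {n} (λ _ → sum-const (suc k) c) ⟩
  sum {n} (λ _ → suc k * c)           ≡⟨ sum-const n (suc k * c) ⟩
  n * (suc k * c)                     ≡⟨ *-assoc n (suc k) c ⟨
  n * suc k * c                       ≡⟨ cong (_* c) (*-comm n (suc k)) ⟩
  suc k * n * c                       ∎
  where open ≡-Reasoning

injective⇒surjective : {f : Fin n → Fin n} → Injective _≡_ _≡_ f → ∀ y → ∃ λ x → f x ≡ y
injective⇒surjective {suc n} {f} f-injective y with Finₚ.any? (λ x → f x Finₚ.≟ y)
... | yes hit  = hit
... | no  miss = contradiction (Finₚ.injective⇒≤ g-injective) 1+n≰n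
  where
  y≢f : ∀ x → y ≢ f x
  y≢f x = miss ∘ (x ,_) ∘ sym
  g : Fin (suc n) → Fin n
  g x = Fin.punchOut (y≢f x)
  g-injective : Injective _≡_ _≡_ g
  g-injective {x} {x′} = f-injective ∘ Finₚ.punchOut-injective (y≢f x) (y≢f x′)

bounded-injective⇒onto : ∀ {N} (f : Fin N → ℕ) → (∀ a → 1 ≤ f a × f a ≤ N) → Injective _≡_ _≡_ f →
  ∀ m → 1 ≤ m → m ≤ N → ∃ λ a → f a ≡ m
bounded-injective⇒onto {N} f bounds f-injective (suc m) _ m<N = a , (begin
    f a                      ≡⟨ suc-pred[f] a ⟨
    suc (pred (f a))         ≡⟨ cong suc (toℕ-fromℕ< _) ⟨
    suc (toℕ (g a))          ≡⟨ cong (suc ∘ toℕ) (proj₂ preimage) ⟩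
    suc (toℕ (fromℕ< m<N))   ≡⟨ cong suc (toℕ-fromℕ< m<N) ⟩
    suc m                    ∎)
  where
  open ≡-Reasoning
  suc-pred[f] : ∀ a → suc (pred (f a)) ≡ f a
  suc-pred[f] a = suc-pred (f a) {{>-nonZero (proj₁ (bounds a))}}
  g : Fin N → Fin N
  g a = fromℕ< (≤-trans (≤-reflexive (suc-pred[f] a)) (proj₂ (bounds a)))
  g-injective : Injective _≡_ _≡_ g
  g-injective {a} {b} ga≡gb = f-injective (begin
    f a                ≡⟨ suc-pred[f] a ⟨
    suc (pred (f a))   ≡⟨ cong suc (Finₚ.fromℕ<-injective _ _ _ _ ga≡gb) ⟩
    suc (pred (f b))   ≡⟨ suc-pred[f] b ⟩
    f b                ∎)
  preimage : ∃ λ a → g a ≡ fromℕ< m<N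
  preimage = injective⇒surjective g-injective (fromℕ< m<N)
  a : Fin N
  a = proj₁ preimage

inject₁<suc : (i : Fin n) → inject₁ i Fin.< suc i
inject₁<suc i = s≤s (≤-reflexive (toℕ-inject₁ i))

inject₁-mono-< : {i j : Fin n} → i Fin.< j → inject₁ i Fin.< inject₁ j
inject₁-mono-< {i = i} {j} = subst₂ _<_ (sym (toℕ-inject₁ i)) (sym (toℕ-inject₁ j))

inject₁-cancel-< : {i j : Fin n} → inject₁ i Fin.< inject₁ j → i Fin.< j
inject₁-cancel-< {i = i} {j} = subst₂ _<_ (toℕ-inject₁ i) (toℕ-inject₁ j)

inject₁<fromℕ : (i : Fin n) → inject₁ i Fin.< fromℕ n
inject₁<fromℕ {n} i = subst₂ _<_ (sym (toℕ-inject₁ i)) (sym (toℕ-fromℕ n)) (toℕ<n i)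

strictlyIncreasing⇒monotone : {f : Fin n → ℕ} → StrictlyIncreasing f →
  ∀ {i j} → toℕ i ≤ toℕ j → f i ≤ f j
strictlyIncreasing⇒monotone {f = f} f-inc {i} {j} i≤j with m≤n⇒m<n∨m≡n i≤j
... | inj₁ i<j = <⇒≤ (f-inc i j i<j)
... | inj₂ i≡j = ≤-reflexive (cong f (toℕ-injective i≡j))

CellInjective : Array k n → Set
CellInjective T = ∀ i j i′ j′ → T i j ≡ T i′ j′ → i ≡ i′ × j ≡ j′

module _ (T∈𝒯 : InT k n T) where
  bounded : ∀ i j → 1 ≤ T i j × T i j ≤ suc k * n
  bounded = proj₁ (proj₁ T∈𝒯)

  onto : ∀ m → 1 ≤ m → m ≤ suc k * n → ∃[ i ] ∃[ j ] (T i j ≡ m)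
  onto = proj₁ (proj₂ (proj₁ T∈𝒯))

  cellInjective : CellInjective T
  cellInjective = proj₂ (proj₂ (proj₁ T∈𝒯))

  rowsIncreasing : RowsIncreasing k n T
  rowsIncreasing = proj₁ (proj₂ T∈𝒯)

  columnsIncreasing : ColumnsIncreasing k n T
  columnsIncreasing = proj₁ (proj₂ (proj₂ T∈𝒯))

  avoiding : Avoiding k n T
  avoiding = proj₂ (proj₂ (proj₂ T∈𝒯))

  above<below : ∀ r j → T (inject₁ r) j < T (suc r) j
  above<below r j = columnsIncreasing (inject₁ r) (suc r) j (inject₁<suc r)

  top≤ : ∀ i j → T zero j ≤ T i j
  top≤ zero    j = ≤-refl
  top≤ (suc r) j = <⇒≤ (columnsIncreasing zero (suc r) j (s≤s z≤n))

-- Uniqueness given the top row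

AgreeBelow : ℕ → Array k n → Array k n → Set
AgreeBelow m T T′ = (∀ i j → T i j < m → T′ i j ≡ T i j) × (∀ i j → T′ i j < m → T i j ≡ T′ i j)

-- If the entry a above m in T is smaller than the entry b above m in T′, then a < b < m < d in T′,
-- where d is the entry below a, unless m lies in the column of a.
crossing : InT k n T → InT k n T′ → AgreeBelow m T T′ → ∀ {r r′ j j′} →
  T (suc r) j ≡ m → T′ (suc r′) j′ ≡ m → T (inject₁ r) j < T′ (inject₁ r′) j′ → j ≡ j′
crossing {T = T} {T′ = T′} {m = m} T∈𝒯 T′∈𝒯 (agree , agree′) {r} {r′} {j} {j′} e e′ a<b
  with <-cmp (T′ (suc r) j) m
... | tri< d<m _ _ = ⊥-elim (<-irrefl (trans (sym (agree′ (suc r) j d<m)) e) d<m)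
... | tri≈ _ d≡m _ = proj₂ (cellInjective T′∈𝒯 _ _ _ _ (trans d≡m (sym e′)))
... | tri> _ _ m<d = ⊥-elim (avoiding T′∈𝒯 r j (inject₁ r′) (suc r′) j′
        (subst (_< T′ (inject₁ r′) j′) (sym a′≡a) a<b)
        (above<below T′∈𝒯 r′ j′)
        (subst (_< T′ (suc r) j) (sym e′) m<d))
  where
  a′≡a : T′ (inject₁ r) j ≡ T (inject₁ r) j
  a′≡a = agree (inject₁ r) j (subst (T (inject₁ r) j <_) e (above<below T∈𝒯 r j))

same-column : InT k n T → InT k n T′ → (∀ j → T zero j ≡ T′ zero j) → AgreeBelow m T T′ →
  ∀ {i j i′ j′} → T i j ≡ m → T′ i′ j′ ≡ m → j ≡ j′
same-column T∈𝒯 T′∈𝒯 top _ {zero} {j} e e′ =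
  proj₂ (cellInjective T′∈𝒯 _ _ _ _ (trans (sym (top j)) (trans e (sym e′))))
same-column T∈𝒯 T′∈𝒯 top _ {suc r} {i′ = zero} {j′} e e′ =
  proj₂ (cellInjective T∈𝒯 _ _ _ _ (trans e (trans (sym e′) (sym (top j′)))))
same-column {T = T} {T′ = T′} T∈𝒯 T′∈𝒯 top agree {suc r} {j} {suc r′} {j′} e e′
  with <-cmp (T (inject₁ r) j) (T′ (inject₁ r′) j′)
... | tri< a<b _ _ = crossing T∈𝒯 T′∈𝒯 agree e e′ a<b
... | tri> _ _ b<a = sym (crossing T′∈𝒯 T∈𝒯 (swap agree) e′ e b<a)
... | tri≈ _ a≡b _ = proj₂ (cellInjective T∈𝒯 _ _ _ _ (trans a≡b (sym b≡b′)))
  where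
  b≡b′ : T (inject₁ r′) j′ ≡ T′ (inject₁ r′) j′
  b≡b′ = proj₂ agree (inject₁ r′) j′ (subst (T′ (inject₁ r′) j′ <_) e′ (above<below T′∈𝒯 r′ j′))

same-row : InT k n T → InT k n T′ → AgreeBelow m T T′ →
  ∀ {i i′ j} → T i j ≡ m → T′ i′ j ≡ m → i ≡ i′
same-row {T = T} {T′ = T′} {m = m} T∈𝒯 T′∈𝒯 (agree , agree′) {i} {i′} {j} e e′ with Finₚ.<-cmp i i′
... | tri≈ _ i≡i′ _ = i≡i′
... | tri< i<i′ _ _ = ⊥-elim (<-irrefl (trans (sym (agree′ i j below)) e) below)
  where
  below : T′ i j < m
  below = subst (T′ i j <_) e′ (columnsIncreasing T′∈𝒯 i i′ j i<i′)
... | tri> _ _ i′<i = ⊥-elim (<-irrefl (trans (sym (agree i′ j below)) e′) below)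
  where
  below : T i′ j < m
  below = subst (T i′ j <_) e (columnsIncreasing T∈𝒯 i′ i j i′<i)

agree-at : InT k n T → InT k n T′ → (∀ j → T zero j ≡ T′ zero j) → AgreeBelow m T T′ →
  ∀ i j → T i j ≡ m → T′ i j ≡ m
agree-at T∈𝒯 T′∈𝒯 top agree i j e
  with i′ , j′ , e′ ← onto T′∈𝒯 _ (subst (1 ≤_) e (proj₁ (bounded T∈𝒯 i j)))
                                  (subst (_≤ _) e (proj₂ (bounded T∈𝒯 i j)))
  with refl ← same-column T∈𝒯 T′∈𝒯 top agree e e′
  with refl ← same-row T∈𝒯 T′∈𝒯 agree e e′ = e′

agreeBelow-sucˡ : InT k n T → InT k n T′ → (∀ j → T zero j ≡ T′ zero j) → AgreeBelow m T T′ →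
  ∀ i j → T i j < suc m → T′ i j ≡ T i j
agreeBelow-sucˡ T∈𝒯 T′∈𝒯 top agree i j lt with m≤n⇒m<n∨m≡n (s≤s⁻¹ lt)
... | inj₁ below = proj₁ agree i j below
... | inj₂ e     = trans (agree-at T∈𝒯 T′∈𝒯 top agree i j e) (sym e)

agreeBelow-suc : InT k n T → InT k n T′ → (∀ j → T zero j ≡ T′ zero j) →
  AgreeBelow m T T′ → AgreeBelow (suc m) T T′
agreeBelow-suc T∈𝒯 T′∈𝒯 top agree =
  agreeBelow-sucˡ T∈𝒯 T′∈𝒯 top agree , agreeBelow-sucˡ T′∈𝒯 T∈𝒯 (sym ∘ top) (swap agree)

topRow-determines : InT k n T → InT k n T′ → (∀ j → topRow T j ≡ topRow T′ j) →
  ∀ i j → T i j ≡ T′ i j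
topRow-determines {T = T} {T′ = T′} T∈𝒯 T′∈𝒯 top i j =
  sym (proj₁ (agreeBelow (suc (T i j))) i j ≤-refl)
  where
  agreeBelow : ∀ m → AgreeBelow m T T′
  agreeBelow zero    = (λ _ _ ()) , (λ _ _ ())
  agreeBelow (suc m) = agreeBelow-suc T∈𝒯 T′∈𝒯 top (agreeBelow m)

-- The bound on the top row

left-of-top : InT k n T → ∀ {i c} j → T i c < T zero j → toℕ c < toℕ j
left-of-top T∈𝒯 {i} {c} j lt = ≰⇒> λ j≤c →
  <⇒≱ lt (≤-trans (strictlyIncreasing⇒monotone (rowsIncreasing T∈𝒯 zero) j≤c) (top≤ T∈𝒯 i c))

fewer-than-top : InT k n T → ∀ j p → p < T zero j → p ≤ toℕ j * suc k
fewer-than-top {k} {n} {T} T∈𝒯 j p p<top = Finₚ.injective⇒≤ place-injective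
  where
  located : (v : Fin p) → ∃[ i ] ∃[ c ] (T i c ≡ suc (toℕ v))
  located v = onto T∈𝒯 (suc (toℕ v)) (s≤s z≤n)
    (≤-trans (<⇒≤ (≤-<-trans (toℕ<n v) p<top)) (proj₂ (bounded T∈𝒯 zero j)))
  row : Fin p → Fin (suc k)
  row v = proj₁ (located v)
  col : Fin p → Fin n
  col v = proj₁ (proj₂ (located v))
  value : ∀ v → T (row v) (col v) ≡ suc (toℕ v)
  value v = proj₂ (proj₂ (located v))
  col<j : ∀ v → toℕ (col v) < toℕ j
  col<j v = left-of-top T∈𝒯 j (subst (_< T zero j) (sym (value v)) (≤-<-trans (toℕ<n v) p<top))
  place : Fin p → Fin (toℕ j * suc k)
  place v = combine (fromℕ< (col<j v)) (row v)
  place-injective : Injective _≡_ _≡_ place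
  place-injective {v} {w} eq
    with c≡c′ , r≡r′ ← Finₚ.combine-injective (fromℕ< (col<j v)) (row v) (fromℕ< (col<j w)) (row w) eq =
    toℕ-injective (suc-injective (begin
      suc (toℕ v)            ≡⟨ value v ⟨
      T (row v) (col v)      ≡⟨ cong₂ T r≡r′ (toℕ-injective (Finₚ.fromℕ<-injective _ _ _ _ c≡c′)) ⟩
      T (row w) (col w)      ≡⟨ value w ⟩
      suc (toℕ w)            ∎))
    where open ≡-Reasoning

topRow-bound : InT k n T → ∀ j → T zero j ≤ 1 + toℕ j * suc k
topRow-bound {k = k} {T = T} T∈𝒯 j = begin
  T zero j              ≡⟨ suc-pred (T zero j) ⟨
  suc (pred (T zero j)) ≤⟨ s≤s (fewer-than-top T∈𝒯 j _ (≤-reflexive (suc-pred (T zero j)))) ⟩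
  1 + toℕ j * suc k     ∎
  where
  open ≤-Reasoning
  instance
    top≢0 : NonZero (T zero j)
    top≢0 = >-nonZero (proj₁ (bounded T∈𝒯 zero j))

-- Rank arrays

OrderPreserving : Array k n → Array k n → Set
OrderPreserving S T = ∀ i j i′ j′ → S i j < S i′ j′ → T i j < T i′ j′

preserves-rowsIncreasing : OrderPreserving S T → RowsIncreasing k n S → RowsIncreasing k n T
preserves-rowsIncreasing S⇒T rows i j j′ lt = S⇒T i j i j′ (rows i j j′ lt)

preserves-columnsIncreasing : OrderPreserving S T →
  ColumnsIncreasing k n S → ColumnsIncreasing k n T
preserves-columnsIncreasing S⇒T columns i i′ j lt = S⇒T i j i′ j (columns i i′ j lt)

reflects-avoiding : OrderPreserving T S → Avoiding k n S → Avoiding k n T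
reflects-avoiding T⇒S avoid r j s s′ c a<b b<c c<d =
  avoid r j s s′ c (T⇒S _ _ _ _ a<b) (T⇒S _ _ _ _ b<c) (T⇒S _ _ _ _ c<d)

countAtMost : Array k n → ℕ → ℕ
countAtMost S v = ∑cells λ i j → 𝟙 (S i j ≤? v)

countAtMost-cong : {S′ : Array k n} {v w : ℕ} → (∀ i j → (S i j ≤ v) ⇔ (S′ i j ≤ w)) →
  countAtMost S v ≡ countAtMost S′ w
countAtMost-cong {n = n} {S = S} {S′} {v} {w} S⇔S′ =
  sum-cong-≗ {n} λ j → sum-cong-≗ λ i → 𝟙-cong (S i j ≤? v) (S′ i j ≤? w) (S⇔S′ i j)

countAtMost-init-last : ∀ (S : Array k (suc n)) w →
  countAtMost S w ≡ countAtMost (λ i c → S i (inject₁ c)) w + sum (λ i → 𝟙 (S i (fromℕ n) ≤? w))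
countAtMost-init-last S w = sum-init-last (λ j → sum λ i → 𝟙 (S i j ≤? w))

rank : Array k n → Array k n
rank S i j = countAtMost S (S i j)

rank-preserves-< : OrderPreserving S (rank S)
rank-preserves-< {S = S} i j i′ j′ lt = ∑cells-mono-<
  (λ s c → 𝟙-mono (S s c ≤? S i j) (S s c ≤? S i′ j′) (λ le → ≤-trans le (<⇒≤ lt)))
  i′ j′ (𝟙-< (S i′ j′ ≤? S i j) (S i′ j′ ≤? S i′ j′) (<⇒≱ lt) ≤-refl)

rank-injective : CellInjective S → CellInjective (rank S)
rank-injective {S = S} S-injective i j i′ j′ eq with <-cmp (S i j) (S i′ j′)
... | tri< lt _ _ = contradiction eq (<⇒≢ (rank-preserves-< i j i′ j′ lt))
... | tri≈ _ e _  = S-injective i j i′ j′ e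
... | tri> _ _ gt = contradiction (sym eq) (<⇒≢ (rank-preserves-< i′ j′ i j gt))

rank-reflects-< : CellInjective S → OrderPreserving (rank S) S
rank-reflects-< {S = S} S-injective i j i′ j′ lt with <-cmp (S i j) (S i′ j′)
... | tri< lt′ _ _ = lt′
... | tri≈ _ e _ with refl , refl ← S-injective i j i′ j′ e = ⊥-elim (<-irrefl refl lt)
... | tri> _ _ gt = ⊥-elim (<-asym lt (rank-preserves-< i′ j′ i j gt))

rank-bounded : ∀ {k n} {S : Array k n} i j → 1 ≤ rank S i j × rank S i j ≤ suc k * n
rank-bounded {k} {n} {S} i j = positive , atMostCells
  where
  positive : 0 < rank S i j
  positive = subst (_< rank S i j) (trans (∑cells-const {k} {n} 0) (*-zeroʳ (suc k * n)))
    (∑cells-mono-< {k} {n} {f = λ _ _ → 0} {g = λ s c → 𝟙 (S s c ≤? S i j)} (λ _ _ → z≤n) i j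
      (≤-reflexive (sym (𝟙-yes (S i j ≤? S i j) ≤-refl))))
  atMostCells : rank S i j ≤ suc k * n
  atMostCells = ≤-trans (∑cells-mono-≤ {k} {n} {g = λ _ _ → 1} (λ s c → 𝟙≤1 (S s c ≤? S i j)))
    (≤-reflexive (trans (∑cells-const {k} {n} 1) (*-identityʳ (suc k * n))))

rank-onto : ∀ {k n} {S : Array k n} → CellInjective S →
  ∀ m → 1 ≤ m → m ≤ suc k * n → ∃[ i ] ∃[ j ] (rank S i j ≡ m)
rank-onto {k} {n} {S} S-injective m 1≤m m≤N =
  proj₁ (remQuot n (proj₁ hit)) , proj₂ (remQuot n (proj₁ hit)) , proj₂ hit
  where
  ranked-injective : Injective _≡_ _≡_ (uncurry (rank S) ∘ remQuot {suc k} n)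
  ranked-injective {a} {b} eq = begin
    a                              ≡⟨ Finₚ.combine-remQuot n a ⟨
    uncurry combine (remQuot n a)
      ≡⟨ cong (uncurry combine) (×-≡,≡→≡ (rank-injective S-injective _ _ _ _ eq)) ⟩
    uncurry combine (remQuot n b)  ≡⟨ Finₚ.combine-remQuot n b ⟩
    b                              ∎
    where open ≡-Reasoning
  hit : ∃ λ a → rank S (proj₁ (remQuot n a)) (proj₂ (remQuot n a)) ≡ m
  hit = bounded-injective⇒onto (uncurry (rank S) ∘ remQuot n)
    (λ a → uncurry (rank-bounded {S = S}) (remQuot n a)) ranked-injective m 1≤m m≤N

rank-InT : CellInjective S → RowsIncreasing k n S → ColumnsIncreasing k n S → Avoiding k n S →
  InT k n (rank S)
rank-InT S-injective rows columns avoid =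
  (rank-bounded , rank-onto S-injective , rank-injective S-injective)
  , preserves-rowsIncreasing rank-preserves-< rows
  , preserves-columnsIncreasing rank-preserves-< columns
  , reflects-avoiding (rank-reflects-< S-injective) avoid

-- Realising a top row

shift : ℕ → (Fin n → ℕ) → Array k n
shift U x i j = toℕ i * U + x j

shift-rowsIncreasing : ∀ {U} {x : Fin n → ℕ} → StrictlyIncreasing x → RowsIncreasing k n (shift U x)
shift-rowsIncreasing {U = U} x-increasing i j j′ lt = +-monoʳ-< (toℕ i * U) (x-increasing j j′ lt)

shift-columnsIncreasing : ∀ {U} {x : Fin n → ℕ} → 1 ≤ U → ColumnsIncreasing k n (shift U x)
shift-columnsIncreasing {U = U} {x = x} 1≤U i i′ j lt =
  +-monoˡ-< (x j) (*-monoˡ-< U {{>-nonZero 1≤U}} lt)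

shift-avoiding : ∀ {U} {x : Fin n → ℕ} → Avoiding k n (shift U x)
shift-avoiding {U = U} {x = x} r j s s′ c a<b b<c c<d = <-asym c<d d<c
  where
  s<s′ : toℕ s < toℕ s′
  s<s′ = *-cancelʳ-< _ _ _ (+-cancelʳ-< (x c) _ _ b<c)
  open ≤-Reasoning
  d<c : shift U x (suc r) j < shift U x s′ c
  d<c = begin-strict
    U + toℕ r * U + x j               ≡⟨ +-assoc U (toℕ r * U) (x j) ⟩
    U + (toℕ r * U + x j)             ≡⟨ cong (λ z → U + (z * U + x j)) (toℕ-inject₁ r) ⟨
    U + shift U x (inject₁ r) j       <⟨ +-monoʳ-< U a<b ⟩
    U + (toℕ s * U + x c)             ≡⟨ +-assoc U (toℕ s * U) (x c) ⟨
    suc (toℕ s) * U + x c             ≤⟨ +-monoˡ-≤ (x c) (*-monoˡ-≤ U s<s′) ⟩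
    shift U x s′ c                    ∎

record Realisation (k n : ℕ) (t : Fin n → ℕ) : Set where
  field
    U               : ℕ
    x               : Fin n → ℕ
    1≤U             : 1 ≤ U
    x-increasing    : StrictlyIncreasing x
    shift-injective : CellInjective (shift {k = k} U x)
    realises        : ∀ j → rank (shift {k = k} U x) zero j ≡ t j

  array : Array k n
  array = rank (shift U x)

  array-InT : InT k n array
  array-InT = rank-InT shift-injective (shift-rowsIncreasing x-increasing)
    (shift-columnsIncreasing 1≤U) shift-avoiding

one-column : {t : Fin 1 → ℕ} → t zero ≡ 1 → Realisation k 1 t
one-column {k} {t} t₀≡1 = record
  { U               = 1
  ; x               = λ _ → 0
  ; 1≤U             = ≤-refl
  ; x-increasing    = λ { zero zero () }
  ; shift-injective = λ { i zero i′ zero eq → toℕ-injective (row-injective eq) , refl }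
  ; realises        = λ { zero → trans (+-identityʳ _) (trans counted (sym t₀≡1)) }
  }
  where
  row-injective : ∀ {a b} → a * 1 + 0 ≡ b * 1 + 0 → a ≡ b
  row-injective = *-cancelʳ-≡ _ _ 1 ∘ +-cancelʳ-≡ 0 _ _
  counted : sum {suc k} (λ i → 𝟙 (toℕ i * 1 + 0 ≤? 0)) ≡ 1
  counted = sum-𝟙-first {k} (λ i → toℕ i * 1 + 0 ≤? 0) z≤n (λ _ ())

double-≤⇔ : ∀ {a b} → 2 * a ≤ 2 * b ⇔ a ≤ b
double-≤⇔ = mk⇔ (*-cancelˡ-≤ 2) (*-monoʳ-≤ 2)

double-≤-odd⇔ : ∀ {a b} → 2 * a ≤ suc (2 * b) ⇔ a ≤ b
double-≤-odd⇔ {a} {b} = mk⇔ (λ le → ≮⇒≥ λ b<a → 1+n≰n (≤-trans (≤-reflexive (sym (*-suc 2 b)))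
                                                         (≤-trans (*-monoʳ-≤ 2 b<a) le)))
                            (λ a≤b → m≤n⇒m≤1+n (*-monoʳ-≤ 2 a≤b))

odd-≤-odd⇔ : ∀ {a b} → suc (2 * a) ≤ suc (2 * b) ⇔ a ≤ b
odd-≤-odd⇔ = mk⇔ (to double-≤⇔ ∘ s≤s⁻¹) (s≤s ∘ from double-≤⇔)

odd-≤-double⇒< : ∀ {a b} → suc (2 * a) ≤ 2 * b → a < b
odd-≤-double⇒< le = ≰⇒> λ b≤a → 1+n≰n (≤-trans le (*-monoʳ-≤ 2 b≤a))

double≢odd : ∀ a b → 2 * a ≢ suc (2 * b)
double≢odd a b eq =
  <⇒≱ (odd-≤-double⇒< (≤-reflexive (sym eq))) (to (double-≤-odd⇔ {a} {b}) (≤-reflexive eq))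

double-shift : ∀ a U b → a * (2 * U) + 2 * b ≡ 2 * (a * U + b)
double-shift = solve-∀

snocView : (Fin n → ℕ) → ℕ → {j : Fin (suc n)} → Top.View j → ℕ
snocView f y ‵fromℕ       = y
snocView f y (‵inject₁ c) = f c

snoc : (Fin n → ℕ) → ℕ → Fin (suc n) → ℕ
snoc f y j = snocView f y (Top.view j)

snoc-inject₁ : ∀ (f : Fin n → ℕ) y c → snoc f y (inject₁ c) ≡ f c
snoc-inject₁ f y c = cong (snocView f y) (Top.view-inject₁ c)

snoc-fromℕ : ∀ (f : Fin n → ℕ) y → snoc f y (fromℕ n) ≡ y
snoc-fromℕ {n} f y = cong (snocView f y) (Top.view-fromℕ n)

-- The old keys are doubled and row i of the new column gets the odd key 2 (K + i U) + 1, where K is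
-- the key of the entry pred τ of the old array; so the new top entry has rank τ.
module Extension {k n} {t : Fin (suc (suc n)) → ℕ} (t-increasing : StrictlyIncreasing t)
  (t-last : t (fromℕ (suc n)) ≤ suc (suc k * suc n)) (R : Realisation k (suc n) (t ∘ inject₁))
  where

  open Realisation R

  old : Array k (suc n)
  old = shift U x

  τ : ℕ
  τ = t (fromℕ (suc n))

  earlier≤pred-τ : ∀ c → rank old zero c ≤ pred τ
  earlier≤pred-τ c = subst (_≤ pred τ) (sym (realises c))
    (suc[m]≤n⇒m≤pred[n] (t-increasing _ _ (inject₁<fromℕ c)))

  instance
    τ≢0 : NonZero τ
    τ≢0 = >-nonZero (≤-<-trans z≤n (t-increasing _ _ (inject₁<fromℕ zero)))

  pivot : ∃[ s ] ∃[ c ] (rank old s c ≡ pred τ)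
  pivot = rank-onto shift-injective (pred τ)
    (≤-trans (proj₁ (rank-bounded {S = old} zero zero)) (earlier≤pred-τ zero)) (pred-mono-≤ t-last)

  K : ℕ
  K = old (proj₁ pivot) (proj₁ (proj₂ pivot))

  atMost-K : countAtMost old K ≡ pred τ
  atMost-K = proj₂ (proj₂ pivot)

  x≤K : ∀ c → x c ≤ K
  x≤K c = ≮⇒≥ λ K<x →
    <⇒≱ (rank-preserves-< {S = old} (proj₁ pivot) (proj₁ (proj₂ pivot)) zero c K<x)
        (subst (rank old zero c ≤_) (sym atMost-K) (earlier≤pred-τ c))

  V : Fin (suc k) → ℕ
  V i = toℕ i * U + K

  K<V-suc : ∀ i → K < V (suc i)
  K<V-suc i = +-monoˡ-≤ K (≤-trans 1≤U (m≤m+n U (toℕ i * U)))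

  V-injective : ∀ {i i′} → V i ≡ V i′ → i ≡ i′
  V-injective = toℕ-injective ∘ *-cancelʳ-≡ _ _ U {{>-nonZero 1≤U}} ∘ +-cancelʳ-≡ K _ _

  x′ : Fin (suc (suc n)) → ℕ
  x′ = snoc (λ c → 2 * x c) (suc (2 * K))

  x′-inject₁ : ∀ c → x′ (inject₁ c) ≡ 2 * x c
  x′-inject₁ = snoc-inject₁ (λ c → 2 * x c) (suc (2 * K))

  x′-last : x′ (fromℕ (suc n)) ≡ suc (2 * K)
  x′-last = snoc-fromℕ (λ c → 2 * x c) (suc (2 * K))

  new : Array k (suc (suc n))
  new = shift (2 * U) x′

  new-inject₁ : ∀ i c → new i (inject₁ c) ≡ 2 * old i c
  new-inject₁ i c = trans (cong (toℕ i * (2 * U) +_) (x′-inject₁ c)) (double-shift (toℕ i) U (x c))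

  new-last : ∀ i → new i (fromℕ (suc n)) ≡ suc (2 * V i)
  new-last i = trans (cong (toℕ i * (2 * U) +_) x′-last)
    (trans (+-suc _ _) (cong suc (double-shift (toℕ i) U K)))

  x′-increasing : StrictlyIncreasing x′
  x′-increasing j j′ = increasing (Top.view j) (Top.view j′)
    where
    increasing : ∀ {j j′} → Top.View j → Top.View j′ → j Fin.< j′ → x′ j < x′ j′
    increasing {j′ = j′} ‵fromℕ _ lt = ⊥-elim (<⇒≱ lt (Finₚ.≤fromℕ j′))
    increasing (‵inject₁ c) (‵inject₁ c′) lt = subst₂ _<_ (sym (x′-inject₁ c)) (sym (x′-inject₁ c′))
      (*-monoʳ-< 2 (x-increasing c c′ (inject₁-cancel-< lt)))
    increasing (‵inject₁ c) ‵fromℕ _ = subst₂ _<_ (sym (x′-inject₁ c)) (sym x′-last)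
      (s≤s (*-monoʳ-≤ 2 (x≤K c)))

  new-injective : CellInjective new
  new-injective i j i′ j′ = injective (Top.view j) (Top.view j′)
    where
    injective : ∀ {j j′} → Top.View j → Top.View j′ → new i j ≡ new i′ j′ → i ≡ i′ × j ≡ j′
    injective (‵inject₁ c) (‵inject₁ c′) eq = map₂ (cong inject₁) (shift-injective i c i′ c′
      (*-cancelˡ-≡ _ _ 2 (trans (sym (new-inject₁ i c)) (trans eq (new-inject₁ i′ c′)))))
    injective (‵inject₁ c) ‵fromℕ eq = ⊥-elim (double≢odd (old i c) (V i′)
      (trans (sym (new-inject₁ i c)) (trans eq (new-last i′))))
    injective ‵fromℕ (‵inject₁ c′) eq = ⊥-elim (double≢odd (old i′ c′) (V i)
      (trans (sym (new-inject₁ i′ c′)) (trans (sym eq) (new-last i))))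
    injective ‵fromℕ ‵fromℕ eq = V-injective (*-cancelˡ-≡ _ _ 2
      (suc-injective (trans (sym (new-last i)) (trans eq (new-last i′))))) , refl

  new-earlier : Array k (suc n)
  new-earlier i c = new i (inject₁ c)

  open ≡-Reasoning

  new-rank-earlier : ∀ c → rank new zero (inject₁ c) ≡ t (inject₁ c)
  new-rank-earlier c = begin
    rank new zero (inject₁ c)
      ≡⟨ countAtMost-init-last new w ⟩
    countAtMost new-earlier w + sum (λ i → 𝟙 (new i (fromℕ (suc n)) ≤? w))
      ≡⟨ cong₂ _+_ (countAtMost-cong earlier)
                   (sum-𝟙-none (λ i → new i (fromℕ (suc n)) ≤? w) last) ⟩
    rank old zero c + 0
      ≡⟨ +-identityʳ _ ⟩
    rank old zero c
      ≡⟨ realises c ⟩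
    t (inject₁ c) ∎
    where
    w : ℕ
    w = new zero (inject₁ c)
    earlier : ∀ i c′ → (new-earlier i c′ ≤ w) ⇔ (old i c′ ≤ old zero c)
    earlier i c′ = subst₂ (λ a b → (a ≤ b) ⇔ (old i c′ ≤ old zero c))
      (sym (new-inject₁ i c′)) (sym (new-inject₁ zero c)) double-≤⇔
    last : ∀ i → ¬ (new i (fromℕ (suc n)) ≤ w)
    last i le = <⇒≱ (odd-≤-double⇒< (subst₂ _≤_ (new-last i) (new-inject₁ zero c) le))
                     (≤-trans (x≤K c) (m≤n+m K (toℕ i * U)))

  new-rank-last : rank new zero (fromℕ (suc n)) ≡ τ
  new-rank-last = begin
    rank new zero (fromℕ (suc n))
      ≡⟨ countAtMost-init-last new w ⟩
    countAtMost new-earlier w + sum (λ i → 𝟙 (new i (fromℕ (suc n)) ≤? w))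
      ≡⟨ cong₂ _+_ (countAtMost-cong earlier)
                   (sum-𝟙-first (λ i → new i (fromℕ (suc n)) ≤? w) ≤-refl below) ⟩
    countAtMost old K + 1
      ≡⟨ cong (_+ 1) atMost-K ⟩
    pred τ + 1
      ≡⟨ +-comm (pred τ) 1 ⟩
    suc (pred τ)
      ≡⟨ suc-pred τ ⟩
    τ ∎
    where
    w : ℕ
    w = new zero (fromℕ (suc n))
    earlier : ∀ i c → (new-earlier i c ≤ w) ⇔ (old i c ≤ K)
    earlier i c = subst₂ (λ a b → (a ≤ b) ⇔ (old i c ≤ K))
      (sym (new-inject₁ i c)) (sym (new-last zero)) double-≤-odd⇔
    below : ∀ i → ¬ (new (suc i) (fromℕ (suc n)) ≤ w)
    below i le = <⇒≱ (K<V-suc i) (to odd-≤-odd⇔ (subst₂ _≤_ (new-last (suc i)) (new-last zero) le))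

  extended : Realisation k (suc (suc n)) t
  extended = record
    { U               = 2 * U
    ; x               = x′
    ; 1≤U             = ≤-trans 1≤U (m≤m+n U (U + 0))
    ; x-increasing    = x′-increasing
    ; shift-injective = new-injective
    ; realises        = realises′
    }
    where
    realises′ : ∀ j → rank new zero j ≡ t j
    realises′ j = realisesAt (Top.view j)
      where
      realisesAt : ∀ {j} → Top.View j → rank new zero j ≡ t j
      realisesAt ‵fromℕ       = new-rank-last
      realisesAt (‵inject₁ c) = new-rank-earlier c

realisation : ∀ {t : Fin (suc m) → ℕ} → StrictlyIncreasing t → t zero ≡ 1 →
  (∀ j → t j ≤ 1 + toℕ j * suc k) → Realisation k (suc m) t
realisation {zero}          _           t₀≡1 _ = one-column t₀≡1
realisation {suc m} {k} {t} t-increasing t₀≡1 t≤ =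
  Extension.extended t-increasing last≤ (realisation earlier-increasing t₀≡1 earlier≤)
  where
  last≤ : t (fromℕ (suc m)) ≤ suc (suc k * suc m)
  last≤ = subst (λ z → t (fromℕ (suc m)) ≤ suc z)
    (trans (cong (_* suc k) (toℕ-fromℕ (suc m))) (*-comm (suc m) (suc k))) (t≤ (fromℕ (suc m)))
  earlier-increasing : StrictlyIncreasing (t ∘ inject₁)
  earlier-increasing j j′ = t-increasing (inject₁ j) (inject₁ j′) ∘ inject₁-mono-<
  earlier≤ : ∀ j → t (inject₁ j) ≤ 1 + toℕ j * suc k
  earlier≤ j = subst (λ z → t (inject₁ j) ≤ 1 + z * suc k) (toℕ-inject₁ j) (t≤ (inject₁ j))

-- Rotation and the bottom row

rotate : Array k n → Array k n
rotate {k} {n} T i j = suc (suc k * n) ∸ T (opposite i) (opposite j)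

opposite-reverses-< : {i j : Fin n} → i Fin.< j → opposite j Fin.< opposite i
opposite-reverses-< {i = i} {j} i<j =
  subst₂ _<_ (sym (Finₚ.opposite-prop j)) (sym (Finₚ.opposite-prop i)) (∸-monoʳ-< (s≤s i<j) (toℕ<n j))

opposite-injective : {i j : Fin n} → opposite i ≡ opposite j → i ≡ j
opposite-injective {i = i} {j} eq = begin
  i                       ≡⟨ Finₚ.opposite-involutive i ⟨
  opposite (opposite i)   ≡⟨ cong opposite eq ⟩
  opposite (opposite j)   ≡⟨ Finₚ.opposite-involutive j ⟩
  j                       ∎
  where open ≡-Reasoning

opposite-inject₁ : (r : Fin n) → opposite (inject₁ r) ≡ suc (opposite r)
opposite-inject₁ {n} r = toℕ-injective (begin
  toℕ (opposite (inject₁ r))   ≡⟨ Finₚ.opposite-prop (inject₁ r) ⟩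
  suc n ∸ suc (toℕ (inject₁ r)) ≡⟨ cong (λ z → n ∸ z) (toℕ-inject₁ r) ⟩
  n ∸ toℕ r                    ≡⟨ +-∸-assoc 1 (toℕ<n r) ⟩
  suc (n ∸ suc (toℕ r))        ≡⟨ cong suc (Finₚ.opposite-prop r) ⟨
  toℕ (suc (opposite r))       ∎)
  where open ≡-Reasoning

rotate-InT : InT k n T → InT k n (rotate T)
rotate-InT {k} {n} {T} T∈𝒯 = (bounds , onto′ , injective′) , rows , columns , avoid
  where
  N : ℕ
  N = suc k * n
  ≤N : ∀ i j → T i j ≤ N
  ≤N i j = proj₂ (bounded T∈𝒯 i j)
  reverse : ∀ {i j i′ j′} → T i j < T i′ j′ → suc N ∸ T i′ j′ < suc N ∸ T i j
  reverse lt = ∸-monoʳ-< lt (m≤n⇒m≤1+n (≤N _ _))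
  bounds : ∀ i j → 1 ≤ rotate T i j × rotate T i j ≤ N
  bounds i j = m<n⇒0<n∸m (s≤s (≤N _ _)) , ∸-monoʳ-≤ (suc N) (proj₁ (bounded T∈𝒯 _ _))
  onto′ : ∀ m → 1 ≤ m → m ≤ N → ∃[ i ] ∃[ j ] (rotate T i j ≡ m)
  onto′ m 1≤m m≤N
    with i , j , e ← onto T∈𝒯 (suc N ∸ m) (m<n⇒0<n∸m (s≤s m≤N)) (∸-monoʳ-≤ (suc N) 1≤m) =
    opposite i , opposite j , (begin
      suc N ∸ T (opposite (opposite i)) (opposite (opposite j))
        ≡⟨ cong₂ (λ a b → suc N ∸ T a b) (Finₚ.opposite-involutive i) (Finₚ.opposite-involutive j) ⟩
      suc N ∸ T i j               ≡⟨ cong (suc N ∸_) e ⟩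
      suc N ∸ (suc N ∸ m)         ≡⟨ m∸[m∸n]≡n (m≤n⇒m≤1+n m≤N) ⟩
      m                           ∎)
    where open ≡-Reasoning
  injective′ : CellInjective (rotate T)
  injective′ i j i′ j′ eq with i≡ , j≡ ← cellInjective T∈𝒯 _ _ _ _
    (∸-cancelˡ-≡ (m≤n⇒m≤1+n (≤N _ _)) (m≤n⇒m≤1+n (≤N _ _)) eq) =
    opposite-injective i≡ , opposite-injective j≡
  rows : RowsIncreasing k n (rotate T)
  rows i j j′ lt = reverse (rowsIncreasing T∈𝒯 _ _ _ (opposite-reverses-< lt))
  columns : ColumnsIncreasing k n (rotate T)
  columns i i′ j lt = reverse (columnsIncreasing T∈𝒯 _ _ _ (opposite-reverses-< lt))
  avoid : Avoiding k n (rotate T)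
  avoid r j s s′ c a<b b<c c<d =
    avoiding T∈𝒯 (opposite r) (opposite j) (opposite s′) (opposite s) (opposite c)
      (∸-cancelʳ-< c<d) (∸-cancelʳ-< b<c)
      (subst (λ z → T (opposite s) (opposite c) < T z (opposite j)) (opposite-inject₁ r)
        (∸-cancelʳ-< a<b))

rotate-rotate : InT k n T → ∀ i j → rotate (rotate T) i j ≡ T i j
rotate-rotate {k} {n} {T} T∈𝒯 i j = begin
  suc N ∸ (suc N ∸ T (opposite (opposite i)) (opposite (opposite j)))
    ≡⟨ cong₂ (λ a b → suc N ∸ (suc N ∸ T a b))
             (Finₚ.opposite-involutive i) (Finₚ.opposite-involutive j) ⟩
  suc N ∸ (suc N ∸ T i j)
    ≡⟨ m∸[m∸n]≡n (m≤n⇒m≤1+n (proj₂ (bounded T∈𝒯 i j))) ⟩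
  T i j ∎
  where
  N : ℕ
  N = suc k * n
  open ≡-Reasoning

bottomRow-rotate : ∀ {k n} (T : Array k n) j →
  bottomRow (rotate T) j ≡ suc (suc k * n) ∸ topRow T (opposite j)
bottomRow-rotate {k} {n} T j =
  cong (λ i → suc (suc k * n) ∸ T i (opposite j)) (Finₚ.opposite-involutive zero)

bottomRow-determines : InT k n T → InT k n T′ → (∀ j → bottomRow T j ≡ bottomRow T′ j) →
  ∀ i j → T i j ≡ T′ i j
bottomRow-determines {k} {n} {T} {T′} T∈𝒯 T′∈𝒯 bottom i j = begin
  T i j                    ≡⟨ rotate-rotate T∈𝒯 i j ⟨
  rotate (rotate T) i j    ≡⟨ cong (suc (suc k * n) ∸_) (rotations-agree (opposite i) (opposite j)) ⟩
  rotate (rotate T′) i j   ≡⟨ rotate-rotate T′∈𝒯 i j ⟩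
  T′ i j                   ∎
  where
  open ≡-Reasoning
  rotations-agree : ∀ i j → rotate T i j ≡ rotate T′ i j
  rotations-agree = topRow-determines (rotate-InT T∈𝒯) (rotate-InT T′∈𝒯)
    (λ j → cong (suc (suc k * n) ∸_) (bottom (opposite j)))

topRow-characterisation : {t : Fin (suc m) → ℕ} → StrictlyIncreasing t → t zero ≡ 1 →
  (∃[ T ] (InT k (suc m) T × (∀ j → topRow T j ≡ t j))) ⇔ (∀ j → t j ≤ 1 + toℕ j * suc k)
topRow-characterisation t-increasing t₀≡1 = mk⇔
  (λ (T , T∈𝒯 , top) j → subst (_≤ _) (top j) (topRow-bound T∈𝒯 j))
  (λ t≤ → let open Realisation (realisation t-increasing t₀≡1 t≤) in array , array-InT , realises)

complement-≤⇔ : ∀ {P Q N b} → P + Q ≡ N → b ≤ N → (suc N ∸ b ≤ suc Q) ⇔ (P ≤ b)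
complement-≤⇔ {P} {Q} {b = b} refl b≤N = mk⇔
  (λ le → +-cancelʳ-≤ Q P b (≤-trans (m≤n+m∸n (P + Q) b)
    (+-monoʳ-≤ b (s≤s⁻¹ (subst (_≤ suc Q) (+-∸-assoc 1 b≤N) le)))))
  (λ P≤b → subst (_≤ suc Q) (sym (+-∸-assoc 1 b≤N)) (s≤s (m≤n+o⇒m∸n≤o (P + Q) b (+-monoˡ-≤ Q P≤b))))

cells-split : ∀ (j : Fin n) → suc (toℕ (opposite j)) * suc k + toℕ j * suc k ≡ suc k * n
cells-split {n} {k} j = begin
  suc (toℕ (opposite j)) * suc k + toℕ j * suc k
    ≡⟨ *-distribʳ-+ (suc k) (suc (toℕ (opposite j))) (toℕ j) ⟨
  (suc (toℕ (opposite j)) + toℕ j) * suc k        ≡⟨ cong (_* suc k) columns ⟩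
  n * suc k                                       ≡⟨ *-comm n (suc k) ⟩
  suc k * n                                       ∎
  where
  open ≡-Reasoning
  columns : suc (toℕ (opposite j)) + toℕ j ≡ n
  columns = begin
    suc (toℕ (opposite j)) + toℕ j  ≡⟨ cong (λ z → suc z + toℕ j) (Finₚ.opposite-prop j) ⟩
    suc (n ∸ suc (toℕ j)) + toℕ j   ≡⟨ cong (_+ toℕ j) (+-∸-assoc 1 (toℕ<n j)) ⟨
    n ∸ toℕ j + toℕ j               ≡⟨ m∸n+n≡m (<⇒≤ (toℕ<n j)) ⟩
    n                               ∎

module BottomRow {k m} {b : Fin (suc m) → ℕ} (b-increasing : StrictlyIncreasing b)
  (b-last : b (fromℕ m) ≡ suc k * suc m) where

  N : ℕ
  N = suc k * suc m

  b≤N : ∀ j → b j ≤ N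
  b≤N j = subst (b j ≤_) b-last (strictlyIncreasing⇒monotone b-increasing (Finₚ.≤fromℕ j))

  t : Fin (suc m) → ℕ
  t j = suc N ∸ b (opposite j)

  t-increasing : StrictlyIncreasing t
  t-increasing j j′ lt = ∸-monoʳ-< (b-increasing _ _ (opposite-reverses-< lt)) (m≤n⇒m≤1+n (b≤N _))

  t₀≡1 : t zero ≡ 1
  t₀≡1 = trans (cong (suc N ∸_) b-last) (m+n∸n≡m 1 N)

  t≤⇔ : ∀ j → (t j ≤ 1 + toℕ j * suc k) ⇔ (suc (toℕ (opposite j)) * suc k ≤ b (opposite j))
  t≤⇔ j = complement-≤⇔ (cells-split j) (b≤N (opposite j))

  characterisation : (∃[ T ] (InT k (suc m) T × (∀ j → bottomRow T j ≡ b j)))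
                     ⇔ (∀ j → suc (toℕ j) * suc k ≤ b j)
  characterisation = mk⇔ necessary sufficient
    where
    open ≡-Reasoning
    necessary : (∃[ T ] (InT k (suc m) T × (∀ j → bottomRow T j ≡ b j))) →
      ∀ j → suc (toℕ j) * suc k ≤ b j
    necessary (T , T∈𝒯 , bottom) j =
      subst (λ i → suc (toℕ i) * suc k ≤ b i) (Finₚ.opposite-involutive j)
        (to (t≤⇔ (opposite j)) (subst (_≤ 1 + toℕ (opposite j) * suc k) (cong (suc N ∸_) (bottom _))
          (topRow-bound (rotate-InT T∈𝒯) (opposite j))))
    sufficient : (∀ j → suc (toℕ j) * suc k ≤ b j) →
      ∃[ T ] (InT k (suc m) T × (∀ j → bottomRow T j ≡ b j))
    sufficient b≥ = rotate array , rotate-InT array-InT , bottom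
      where
      open Realisation (realisation t-increasing t₀≡1 (λ j → from (t≤⇔ j) (b≥ (opposite j))))
      bottom : ∀ j → bottomRow (rotate array) j ≡ b j
      bottom j = begin
        bottomRow (rotate array) j              ≡⟨ bottomRow-rotate array j ⟩
        suc N ∸ array zero (opposite j)         ≡⟨ cong (suc N ∸_) (realises (opposite j)) ⟩
        suc N ∸ (suc N ∸ b (opposite (opposite j)))  ≡⟨ m∸[m∸n]≡n (m≤n⇒m≤1+n (b≤N _)) ⟩
        b (opposite (opposite j))               ≡⟨ cong b (Finₚ.opposite-involutive j) ⟩
        b j                                     ∎

lemma4p3 : (k n : ℕ) → 1 ≤ k → 1 ≤ n →
    ((T T′ : Array k n) → InT k n T → InT k n T′ →
        (∀ j → topRow T j ≡ topRow T′ j) → ∀ i j → T i j ≡ T′ i j)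
    × ((T T′ : Array k n) → InT k n T → InT k n T′ →
        (∀ j → bottomRow T j ≡ bottomRow T′ j) → ∀ i j → T i j ≡ T′ i j)
    × ((t : Fin n → ℕ) → StrictlyIncreasing t → (∀ j → toℕ j ≡ 0 → t j ≡ 1) →
        ((∃[ T ] (InT k n T × (∀ j → topRow T j ≡ t j)))
          ⇔ (∀ j → t j ≤ 1 + toℕ j * suc k)))
    × ((b : Fin n → ℕ) → StrictlyIncreasing b → (∀ j → toℕ j ≡ n ∸ 1 → b j ≡ suc k * n) →
        ((∃[ T ] (InT k n T × (∀ j → bottomRow T j ≡ b j)))
          ⇔ (∀ j → suc (toℕ j) * suc k ≤ b j)))
lemma4p3 k (suc m) _ _ =
    (λ _ _ → topRow-determines)
  , (λ _ _ → bottomRow-determines)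
  , (λ t t-increasing t₀≡1 → topRow-characterisation t-increasing (t₀≡1 zero refl))
  , (λ b b-increasing b-last →
       BottomRow.characterisation b-increasing (b-last (fromℕ m) (toℕ-fromℕ m)))
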